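{- Let $m,n\in\mathbb{N}=\{1,2,3,\ldots\}$, let $d\ge 0$ be an integer, let $\mathbf{x}\in[n+1]^m$, and let $\mathbf{x}'=(x_1',x_2',\ldots,x_m')$ be the rearrangement of $\mathbf{x}$ into nondecreasing order. Then $\mathbf{x}$ is a defective parking function with defect $d$ (i.e. $\mathbf{x}\in\mathrm{DPF}_{m,n,d}$) if and only if \[\max\Big(\max_{j\in[m]}\big(x_j'-j+(m-n)\big),\,0\Big)=d.\]
   Context: $[n]=\{1,\ldots,n\}$. A preference list is a tuple $\mathbf{x}=(x_1,\ldots,x_m)\in[n+1]^m$. Cars $1,2,\ldots,m$ arrive in order at an infinitely long one-way street with spots numbered $1,2,3,\ldots$; car $i$ drives to spot $x_i$ and parks there if it is empty, and otherwise parks in the first empty spot after $x_i$. The spots $1,\ldots,n$ constitute the parking lot. The defect $\mathrm{dft}(\mathbf{x})$ is the number of cars that park in a spot numbered greater than $n$ (equivalently, the number of cars that fail to park in the lot under the classical parking scheme). $\mathrm{DPF}_{m,n,d}$ denotes the set of $\mathbf{x}\in[n+1]^m$ with $\mathrm{dft}(\mathbf{x})=d$. -}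

module Defs where

open import Data.Nat using (ℕ; zero; suc; _+_; _≤_; _<_; _≤?_; _<?_)
open import Data.Integer as ℤ using (ℤ; +_; _-_; _⊔_)
open import Data.Product using (_×_)
open import Relation.Binary.PropositionalEquality using (_≡_)
open import Data.List using (List; []; _∷_; length)
open import Data.List.Membership.DecPropositional (Data.Nat._≟_) using (_∈?_)
open import Data.Vec using (Vec; []; _∷_)
open import Data.Fin using (Fin; toℕ)
open import Relation.Nullary using (yes; no)

-- First empty spot at or after position p, given the list of occupied spots.
-- Fuel = number of occupied spots + 1 suffices (each step past p skips an occupied spot).
firstFree : ℕ → List ℕ → ℕ → ℕ
firstFree zero     occ p = p
firstFree (suc k) occ p with p ∈? occ
... | yes _ = firstFree k occ (suc p)
... | no  _ = p

parkSpot : List ℕ → ℕ → ℕ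
parkSpot occ p = firstFree (suc (length occ)) occ p

parkFrom : ∀ {m} → List ℕ → Vec ℕ m → List ℕ
parkFrom occ []       = []
parkFrom occ (x ∷ xs) = let s = parkSpot occ x in s ∷ parkFrom (s ∷ occ) xs

outcome : ∀ {m} → Vec ℕ m → List ℕ
outcome = parkFrom []

countAbove : ℕ → List ℕ → ℕ
countAbove n []       = zero
countAbove n (s ∷ ss) with n <? s
... | yes _ = suc (countAbove n ss)
... | no  _ = countAbove n ss

dft : ∀ {m} → ℕ → Vec ℕ m → ℕ
dft n x = countAbove n (outcome x)

InRange : ∀ {m} → ℕ → Vec ℕ m → Set
InRange {m} n x = (i : Fin m) → 1 ≤ Data.Vec.lookup x i × Data.Vec.lookup x i ≤ suc n

DPF : (m n d : ℕ) → Vec ℕ m → Set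
DPF m n d x = InRange n x × dft n x ≡ d

NonDecreasing : ∀ {m} → Vec ℕ m → Set
NonDecreasing {m} v = (i j : Fin m) → toℕ i ≤ toℕ j → Data.Vec.lookup v i ≤ Data.Vec.lookup v j

-- max over j ∈ [m] of (x'_j - j + (m - n)), together with 0:
-- maxTerm = max( max_{j} (x'_j - j + (m-n)), 0 )   (j is 1-indexed: j = toℕ i + 1)
maxTerm : (m n : ℕ) → Vec ℕ m → ℤ
maxTerm m n x' = go 0 (Data.Vec.toList x')
  where
  go : ℕ → List ℕ → ℤ
  go k []       = + 0
  go k (y ∷ ys) = (((+ y) - (+ suc k)) ℤ.+ ((+ m) - (+ n))) ⊔ go (suc k) ys

-- Write A(t) for the number of preferences ≥ t and F for the defect. Every car
-- parks at or after its preferred spot and no two cars share a spot, so the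
-- cars preferring ≥ t occupy at most the n + 1 − t lot spots from t on plus the
-- F spots beyond the lot: A(t) ≤ (n + 1 − t) + F. If s is the last empty spot
-- of the lot (s = 0 if there is none), no car preferring ≤ s gets past s, so all
-- cars parked at s + 1, …, n and beyond the lot preferred > s: equality holds at
-- t = s + 1. Hence F = max(0, max_t (A(t) + t − (n + 1))). For the sorted list
-- x' we have A(x'_j) ≥ m − j + 1, with equality for t in place of x'_j when x'_j
-- is the first entry ≥ t, so this maximum is the one over the entries of x'.
module Submission where

open import Defs
open import Data.Nat using (ℕ; _≤_)
open import Data.Integer using (+_)
open import Data.Vec using (Vec; toList)
open import Data.List.Relation.Binary.Permutation.Propositional using (_↭_)
open import Relation.Binary.PropositionalEquality using (_≡_)
open import Function.Bundles using (_⇔_)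

open import Data.Nat using (zero; suc; _+_; _∸_; _<_; _≟_; _≤?_; _<?_; z≤n; s≤s; z<s)
open import Data.Nat.Properties
  using ( ≤-refl; ≤-trans; <⇒≤; <⇒≱; ≰⇒>; ≮⇒≥; ≤∧≢⇒<; 1+n≰n; n≤1+n; m≤n⇒m≤1+n
        ; m≤m+n; m<m+n; m+n≤o⇒n≤o; m+[n∸m]≡n; m+n∸m≡n
        ; +-suc; +-assoc; +-identityʳ; +-mono-≤; +-monoʳ-≤; module ≤-Reasoning )
open import Data.Nat.Solver using (module +-*-Solver)
open import Relation.Binary.PropositionalEquality using (refl; sym; trans; cong; cong₂; subst; setoid)
open import Data.Integer as ℤ using (ℤ; _⊖_; _⊔_)
import Data.Integer.Properties as ℤ
import Data.Integer.Solver as ℤ-Solver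
open import Data.List using (List; []; _∷_; [_]; _++_; length; filter)
open import Data.List.Properties using (length-++; ++-identityʳ; filter-accept; filter-reject; filter-all)
open import Data.List.Membership.Propositional using (_∈_; _∉_)
open import Data.List.Membership.Propositional.Properties
  using (∈-∃++; ∈-++⁺ˡ; ∈-++⁺ʳ; ∈-++⁻; ∈-filter⁺; ∈-filter⁻)
open import Data.List.Membership.DecPropositional _≟_ using (_∈?_)
open import Data.List.Relation.Binary.Subset.Propositional using (_⊆_)
open import Data.List.Relation.Binary.Disjoint.Propositional using (Disjoint)
open import Data.List.Relation.Binary.Pointwise as Pointwise using (Pointwise; []; _∷_; All-resp-Pointwise)
open import Data.List.Relation.Binary.Permutation.Propositional using (↭-sym; ↭⇒↭ₛ)
open import Data.List.Relation.Binary.Permutation.Propositional.Properties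
  using (shift; ↭-length; filter-↭; All-resp-↭)
open import Data.List.Relation.Binary.Permutation.Setoid.Properties (setoid ℕ) using (Unique-resp-↭)
open import Data.List.Relation.Unary.Any using (here; there)
open import Data.List.Relation.Unary.All as All using (All; []; _∷_)
open import Data.List.Relation.Unary.All.Properties using (¬Any⇒All¬; All¬⇒¬Any)
open import Data.List.Relation.Unary.AllPairs using (AllPairs; []; _∷_)
open import Data.List.Relation.Unary.Unique.Propositional using (Unique)
import Data.List.Relation.Unary.Unique.Propositional.Properties as Unique
open import Data.Vec using ([]; _∷_; lookup)
open import Data.Vec.Properties using (length-toList)
open import Data.Fin using () renaming (zero to fzero; suc to fsuc)
open import Data.Product using (∃-syntax; _×_; _,_; proj₁; proj₂)
open import Data.Sum using (inj₁; inj₂)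
open import Function using (_∘_)
open import Function.Bundles using (mk⇔)
open import Data.Bool using (true; false)
open import Relation.Nullary using (does; yes; no; contradiction)
open import Relation.Unary using (Pred; Decidable)

module _ {a} {A : Set a} where

  Unique-⊆⇒length-≤ : {xs ys : List A} → Unique xs → xs ⊆ ys → length xs ≤ length ys
  Unique-⊆⇒length-≤ {[]} _ _ = z≤n
  Unique-⊆⇒length-≤ {x ∷ xs} (x∉xs ∷ uniq) x∷xs⊆ys
    with us , vs , refl ← ∈-∃++ (x∷xs⊆ys (here refl)) = begin
      suc (length xs)            ≤⟨ s≤s (Unique-⊆⇒length-≤ uniq xs⊆us++vs) ⟩
      suc (length (us ++ vs))    ≡⟨ ↭-length (shift x us vs) ⟨
      length (us ++ [ x ] ++ vs) ∎
    where
    open ≤-Reasoning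
    xs⊆us++vs : xs ⊆ us ++ vs
    xs⊆us++vs y∈xs with ∈-++⁻ us (x∷xs⊆ys (there y∈xs))
    ... | inj₁ y∈us          = ∈-++⁺ˡ y∈us
    ... | inj₂ (here refl)   = contradiction y∈xs (All¬⇒¬Any x∉xs)
    ... | inj₂ (there y∈vs)  = ∈-++⁺ʳ us y∈vs

module _ {a p} {A : Set a} {P : Pred A p} (P? : Decidable P) where

  length-filter-∷ : ∀ y xs → length (filter P? xs) ≤ length (filter P? (y ∷ xs))
  length-filter-∷ y xs with does (P? y)
  ... | true  = n≤1+n _
  ... | false = ≤-refl

module _ {a b p q} {A : Set a} {B : Set b} {P : Pred A p} {Q : Pred B q}
         (P? : Decidable P) (Q? : Decidable Q) where

  length-filter-mono : ∀ {xs ys} → Pointwise (λ x y → P x → Q y) xs ys →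
                       length (filter P? xs) ≤ length (filter Q? ys)
  length-filter-mono [] = z≤n
  length-filter-mono {x ∷ _} {y ∷ _} (Px⇒Qy ∷ rest) with P? x | Q? y
  ... | yes _  | yes _   = s≤s (length-filter-mono rest)
  ... | yes Px | no ¬Qy  = contradiction (Px⇒Qy Px) ¬Qy
  ... | no _   | yes _   = m≤n⇒m≤1+n (length-filter-mono rest)
  ... | no _   | no _    = length-filter-mono rest

interval : ℕ → ℕ → List ℕ
interval a zero    = []
interval a (suc c) = a ∷ interval (suc a) c

length-interval : ∀ a c → length (interval a c) ≡ c
length-interval a zero    = refl
length-interval a (suc c) = cong suc (length-interval (suc a) c)

∈-interval⁺ : ∀ {a c j} → a ≤ j → j < a + c → j ∈ interval a c
∈-interval⁺ {a} {zero} a≤j j<a+0 = contradiction a≤j (<⇒≱ (subst (_ <_) (+-identityʳ a) j<a+0))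
∈-interval⁺ {a} {suc c} {j} a≤j j<a+1+c with a ≟ j
... | yes refl = here refl
... | no a≢j   = there (∈-interval⁺ (≤∧≢⇒< a≤j a≢j) (subst (j <_) (+-suc a c) j<a+1+c))

∈-interval⁻ : ∀ {a c j} → j ∈ interval a c → a ≤ j × j < a + c
∈-interval⁻ {a} {suc c} (here refl) = ≤-refl , m<m+n a z<s
∈-interval⁻ {a} {suc c} {j} (there j∈) =
  let a<j , j<1+a+c = ∈-interval⁻ j∈ in <⇒≤ a<j , subst (j <_) (sym (+-suc a c)) j<1+a+c

interval-unique : ∀ a c → Unique (interval a c)
interval-unique a zero    = []
interval-unique a (suc c) = ¬Any⇒All¬ _ (1+n≰n ∘ proj₁ ∘ ∈-interval⁻) ∷ interval-unique (suc a) c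

firstFree-≥ : ∀ k occ p → p ≤ firstFree k occ p
firstFree-≥ zero    occ p = ≤-refl
firstFree-≥ (suc k) occ p with p ∈? occ
... | yes _ = ≤-trans (n≤1+n p) (firstFree-≥ k occ (suc p))
... | no _  = ≤-refl

firstFree-≤-free : ∀ k occ {p s} → p ≤ s → s ∉ occ → firstFree k occ p ≤ s
firstFree-≤-free zero    occ p≤s _ = p≤s
firstFree-≤-free (suc k) occ {p} p≤s s∉occ with p ∈? occ
... | yes p∈occ = firstFree-≤-free k occ (≤∧≢⇒< p≤s λ { refl → s∉occ p∈occ }) s∉occ
... | no _      = p≤s

firstFree-∈⇒interval⊆ : ∀ k occ p → firstFree k occ p ∈ occ → interval p k ⊆ occ
firstFree-∈⇒interval⊆ (suc k) occ p ff∈occ j∈ with p ∈? occ | j∈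
... | yes p∈occ | here refl = p∈occ
... | yes _     | there j∈′ = firstFree-∈⇒interval⊆ k occ (suc p) ff∈occ j∈′
... | no p∉occ  | _         = contradiction ff∈occ p∉occ

-- The fuel suc (length occ) of parkSpot suffices: running out of it would mean
-- that the suc (length occ) distinct spots from p on are all occupied.
parkSpot-∉ : ∀ {occ} p → Unique occ → parkSpot occ p ∉ occ
parkSpot-∉ {occ} p uniq spot∈occ = 1+n≰n (subst (_≤ length occ) (length-interval p _)
  (Unique-⊆⇒length-≤ (interval-unique p _) (firstFree-∈⇒interval⊆ _ occ p spot∈occ)))

parkFrom-unique : ∀ {k} occ (xs : Vec ℕ k) → Unique occ → Unique (parkFrom occ xs ++ occ)
parkFrom-unique occ []       uniq = uniq
parkFrom-unique occ (x ∷ xs) uniq =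
  Unique-resp-↭ (↭⇒↭ₛ (shift s (parkFrom (s ∷ occ) xs) occ))
    (parkFrom-unique (s ∷ occ) xs (¬Any⇒All¬ occ (parkSpot-∉ x uniq) ∷ uniq))
  where s = parkSpot occ x

outcome-unique : ∀ {k} (xs : Vec ℕ k) → Unique (outcome xs)
outcome-unique xs = subst Unique (++-identityʳ _) (parkFrom-unique [] xs [])

parkFrom-≥ : ∀ {k} occ (xs : Vec ℕ k) → Pointwise _≤_ (toList xs) (parkFrom occ xs)
parkFrom-≥ occ []       = []
parkFrom-≥ occ (x ∷ xs) = firstFree-≥ _ occ x ∷ parkFrom-≥ _ xs

parkFrom-beyond-free : ∀ {k s} occ (xs : Vec ℕ k) → s ∉ occ → s ∉ parkFrom occ xs →
                       Pointwise (λ spot pref → s < spot → s < pref) (parkFrom occ xs) (toList xs)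
parkFrom-beyond-free occ [] _ _ = []
parkFrom-beyond-free {s = s} occ (x ∷ xs) s∉occ s∉spots =
  (λ s<spot → ≰⇒> (λ x≤s → <⇒≱ s<spot (firstFree-≤-free _ occ x≤s s∉occ)))
  ∷ parkFrom-beyond-free _ xs s∉spot∷occ (s∉spots ∘ there)
  where
  s∉spot∷occ : s ∉ parkSpot occ x ∷ occ
  s∉spot∷occ (here refl)   = s∉spots (here refl)
  s∉spot∷occ (there s∈occ) = s∉occ s∈occ

lastFreeSpot : ∀ {O} → 0 ∉ O → ∀ n → ∃[ s ] ∃[ c ] s + c ≡ n × s ∉ O × interval (suc s) c ⊆ O
lastFreeSpot {O} 0∉O n =
  let s , c , eq , rest = search n 0 (λ ()) in s , c , trans eq (+-identityʳ n) , rest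
  where
  search : ∀ s c → interval (suc s) c ⊆ O →
           ∃[ s′ ] ∃[ c′ ] s′ + c′ ≡ s + c × s′ ∉ O × interval (suc s′) c′ ⊆ O
  search zero    c occupied = 0 , c , refl , 0∉O , occupied
  search (suc s) c occupied with suc s ∈? O
  ... | no s+1∉O = suc s , c , refl , s+1∉O , occupied
  ... | yes s+1∈O =
    let s′ , c′ , eq , rest = search s (suc c) λ { (here refl) → s+1∈O ; (there j∈) → occupied j∈ }
    in s′ , c′ , trans eq (+-suc s c) , rest

count≥ : ℕ → List ℕ → ℕ
count≥ t xs = length (filter (t ≤?_) xs)

countAbove≡count≥ : ∀ n xs → countAbove n xs ≡ count≥ (suc n) xs
countAbove≡count≥ n [] = refl
countAbove≡count≥ n (s ∷ xs) with n <? s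
... | yes n<s = trans (cong suc (countAbove≡count≥ n xs)) (sym (cong length (filter-accept (suc n ≤?_) n<s)))
... | no n≮s  = trans (countAbove≡count≥ n xs) (sym (cong length (filter-reject (suc n ≤?_) n≮s)))

0∉outcome : ∀ {k} (xs : Vec ℕ k) → All (1 ≤_) (toList xs) → 0 ∉ outcome xs
0∉outcome xs prefs≥1 0∈ = contradiction (All.lookup spots≥1 0∈) λ ()
  where
  spots≥1 : All (1 ≤_) (outcome xs)
  spots≥1 = All-resp-Pointwise (λ p≤q 1≤p → ≤-trans 1≤p p≤q) (parkFrom-≥ [] xs) prefs≥1

module _ {m} (n : ℕ) (x : Vec ℕ m) where

  length-interval++overflow : ∀ a c → length (interval a c ++ filter (suc n ≤?_) (outcome x)) ≡ c + dft n x
  length-interval++overflow a c = trans (length-++ (interval a c))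
    (cong₂ _+_ (length-interval a c) (sym (countAbove≡count≥ n (outcome x))))

  dft-upper : ∀ t c → t + c ≡ suc n → count≥ t (toList x) ≤ c + dft n x
  dft-upper t c t+c≡1+n = begin
    count≥ t (toList x)
      ≤⟨ length-filter-mono (t ≤?_) (t ≤?_)
           (Pointwise.map (λ p≤q t≤p → ≤-trans t≤p p≤q) (parkFrom-≥ [] x)) ⟩
    count≥ t (outcome x)
      ≤⟨ Unique-⊆⇒length-≤ (Unique.filter⁺ (t ≤?_) (outcome-unique x)) split ⟩
    length (interval t c ++ filter (suc n ≤?_) (outcome x))
      ≡⟨ length-interval++overflow t c ⟩
    c + dft n x ∎
    where
    open ≤-Reasoning
    split : filter (t ≤?_) (outcome x) ⊆ interval t c ++ filter (suc n ≤?_) (outcome x)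
    split {s} s∈ with s∈O , t≤s ← ∈-filter⁻ (t ≤?_) {xs = outcome x} s∈ | s <? suc n
    ... | yes s≤n = ∈-++⁺ˡ (∈-interval⁺ t≤s (subst (s <_) (sym t+c≡1+n) s≤n))
    ... | no s≰n  = ∈-++⁺ʳ (interval t c) (∈-filter⁺ (suc n ≤?_) s∈O (≮⇒≥ s≰n))

  dft-attained : All (1 ≤_) (toList x) →
                 ∃[ t ] ∃[ c ] t + c ≡ suc n × c + dft n x ≤ count≥ t (toList x)
  dft-attained prefs≥1
    with s , c , s+c≡n , s∉O , occupied ← lastFreeSpot (0∉outcome x prefs≥1) n
    = suc s , c , cong suc s+c≡n , count-bound
    where
    disjoint : Disjoint (interval (suc s) c) (filter (suc n ≤?_) (outcome x))
    disjoint {j} (j∈I , j∈F) =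
      <⇒≱ (subst (j <_) (cong suc s+c≡n) (proj₂ (∈-interval⁻ j∈I)))
          (proj₂ (∈-filter⁻ (suc n ≤?_) {xs = outcome x} j∈F))
    beyond-s : interval (suc s) c ++ filter (suc n ≤?_) (outcome x) ⊆ filter (suc s ≤?_) (outcome x)
    beyond-s j∈ with ∈-++⁻ (interval (suc s) c) j∈
    ... | inj₁ j∈I = ∈-filter⁺ (suc s ≤?_) (occupied j∈I) (proj₁ (∈-interval⁻ j∈I))
    ... | inj₂ j∈F = let j∈O , n<j = ∈-filter⁻ (suc n ≤?_) {xs = outcome x} j∈F in
      ∈-filter⁺ (suc s ≤?_) j∈O (≤-trans (s≤s (subst (s ≤_) s+c≡n (m≤m+n s c))) n<j)
    count-bound : c + dft n x ≤ count≥ (suc s) (toList x)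
    count-bound = begin
      c + dft n x
        ≡⟨ length-interval++overflow (suc s) c ⟨
      length (interval (suc s) c ++ filter (suc n ≤?_) (outcome x))
        ≤⟨ Unique-⊆⇒length-≤ (Unique.++⁺ (interval-unique (suc s) c)
                                         (Unique.filter⁺ (suc n ≤?_) (outcome-unique x)) disjoint)
                              beyond-s ⟩
      count≥ (suc s) (outcome x)
        ≤⟨ length-filter-mono (suc s ≤?_) (suc s ≤?_) (parkFrom-beyond-free [] x (λ ()) s∉O) ⟩
      count≥ (suc s) (toList x) ∎
      where open ≤-Reasoning

[m+n]⊖m≡n : ∀ m n → (m + n) ⊖ m ≡ + n
[m+n]⊖m≡n m n = trans (ℤ.⊖-≥ (m≤m+n m n)) (cong +_ (m+n∸m≡n m n))

m≤n+o⇒m⊖n≤o : ∀ {m n o} → m ≤ n + o → m ⊖ n ℤ.≤ + o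
m≤n+o⇒m⊖n≤o {n = n} {o} m≤n+o =
  ℤ.≤-trans (ℤ.⊖-monoˡ-≤ n m≤n+o) (ℤ.≤-reflexive ([m+n]⊖m≡n n o))

n+o≤m⇒o≤m⊖n : ∀ {m n o} → n + o ≤ m → + o ℤ.≤ m ⊖ n
n+o≤m⇒o≤m⊖n {n = n} {o} n+o≤m =
  ℤ.≤-trans (ℤ.≤-reflexive (sym ([m+n]⊖m≡n n o))) (ℤ.⊖-monoˡ-≤ n n+o≤m)

module SortedMaximum (m n : ℕ) where

  term : ℕ → ℕ → ℤ
  term k y = ((+ y) ℤ.- (+ suc k)) ℤ.+ ((+ m) ℤ.- (+ n))

  maxFrom : ℕ → List ℕ → ℤ
  maxFrom k []       = + 0
  maxFrom k (y ∷ ys) = term k y ⊔ maxFrom (suc k) ys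

  maxFrom-unique : (G : ℕ → List ℕ → ℤ) → (∀ k → G k [] ≡ + 0) →
                   (∀ k y ys → G k (y ∷ ys) ≡ term k y ⊔ G (suc k) ys) →
                   ∀ k ys → G k ys ≡ maxFrom k ys
  maxFrom-unique G G[] G∷ k []       = G[] k
  maxFrom-unique G G[] G∷ k (y ∷ ys) =
    trans (G∷ k y ys) (cong (term k y ⊔_) (maxFrom-unique G G[] G∷ (suc k) ys))

  -- maxTerm recurses through a local function that cannot be named here:
  -- unfold solves G to it by unification.
  maxTerm≡maxFrom : (x' : Vec ℕ m) → maxTerm m n x' ≡ maxFrom 0 (toList x')
  maxTerm≡maxFrom x' = trans unfold (maxFrom-unique G (λ _ → refl) (λ _ _ _ → refl) 0 (toList x'))
    where
    G : ℕ → List ℕ → ℤ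
    G = _
    unfold : maxTerm m n x' ≡ G 0 (toList x')
    unfold with toList x' | 0
    ... | ys | k = refl

  term≡⊖ : ∀ k y → term k y ≡ (y + m) ⊖ (suc k + n)
  term≡⊖ k y = trans
    (solve 4 (λ y k m n → (y :- k) :+ (m :- n) := (y :+ m) :- (k :+ n)) refl (+ y) (+ suc k) (+ m) (+ n))
    (ℤ.m-n≡m⊖n (y + m) (suc k + n))
    where open ℤ-Solver.+-*-Solver

  k+[1+n+F]≡1+k+n+F : ∀ k F → k + (suc n + F) ≡ (suc k + n) + F
  k+[1+n+F]≡1+k+n+F k F = trans (+-suc k (n + F)) (cong suc (sym (+-assoc k n F)))

  term-≤ : ∀ {F} k y → y + m ≤ k + (suc n + F) → term k y ℤ.≤ + F
  term-≤ {F} k y bound = subst (ℤ._≤ + F) (sym (term≡⊖ k y))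
    (m≤n+o⇒m⊖n≤o (subst (λ z → y + m ≤ z) (k+[1+n+F]≡1+k+n+F k F) bound))

  term-≥ : ∀ {F} k y → k + (suc n + F) ≤ y + m → + F ℤ.≤ term k y
  term-≥ {F} k y bound = subst (+ F ℤ.≤_) (sym (term≡⊖ k y))
    (n+o≤m⇒o≤m⊖n (subst (_≤ y + m) (k+[1+n+F]≡1+k+n+F k F) bound))

  a+[k+[c+F]]≡k+[a+c+F] : ∀ a k c F → a + (k + (c + F)) ≡ k + ((a + c) + F)
  a+[k+[c+F]]≡k+[a+c+F] = solve 4 (λ a k c F → a :+ (k :+ (c :+ F)) := k :+ ((a :+ c) :+ F)) refl
    where open +-*-Solver

  maxFrom-≤ : ∀ {F} k ys → AllPairs _≤_ ys → All (_≤ suc n) ys → k + length ys ≡ m →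
              (∀ t c → t + c ≡ suc n → count≥ t ys ≤ c + F) → maxFrom k ys ℤ.≤ + F
  maxFrom-≤ k [] _ _ _ _ = ℤ.+≤+ z≤n
  maxFrom-≤ {F} k (y ∷ ys) (y≤ys ∷ sorted) (y≤1+n ∷ bounded) len excess =
    ℤ.⊔-lub (term-≤ k y head-bound)
            (maxFrom-≤ (suc k) ys sorted bounded (trans (sym (+-suc k _)) len)
                       (λ t c e → ≤-trans (length-filter-∷ (t ≤?_) y ys) (excess t c e)))
    where
    c = suc n ∸ y
    y+c≡1+n : y + c ≡ suc n
    y+c≡1+n = m+[n∸m]≡n y≤1+n
    count-head : count≥ y (y ∷ ys) ≡ suc (length ys)
    count-head = cong length (filter-all (y ≤?_) (≤-refl ∷ y≤ys))
    head-bound : y + m ≤ k + (suc n + F)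
    head-bound = begin
      y + m                       ≡⟨ cong (_+_ y) len ⟨
      y + (k + suc (length ys))   ≡⟨ cong (λ z → y + (k + z)) count-head ⟨
      y + (k + count≥ y (y ∷ ys)) ≤⟨ +-monoʳ-≤ y (+-monoʳ-≤ k (excess y c y+c≡1+n)) ⟩
      y + (k + (c + F))           ≡⟨ a+[k+[c+F]]≡k+[a+c+F] y k c F ⟩
      k + ((y + c) + F)           ≡⟨ cong (λ z → k + (z + F)) y+c≡1+n ⟩
      k + (suc n + F)             ∎
      where open ≤-Reasoning

  maxFrom-≥ : ∀ {F t c} k ys → AllPairs _≤_ ys → k + length ys ≡ m → t + c ≡ suc n →
              c + F ≤ count≥ t ys → + F ℤ.≤ maxFrom k ys
  maxFrom-≥ {c = c} k [] _ _ _ c+F≤0 = ℤ.+≤+ (m+n≤o⇒n≤o c c+F≤0)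
  maxFrom-≥ {F} {t} {c} k (y ∷ ys) (y≤ys ∷ sorted) len t+c≡1+n c+F≤count with t ≤? y
  ... | yes t≤y = ℤ.≤-trans (term-≥ k y head-bound) (ℤ.i≤i⊔j _ _)
    where
    count-head : count≥ t (y ∷ ys) ≡ suc (length ys)
    count-head = cong length (filter-all (t ≤?_) (t≤y ∷ All.map (≤-trans t≤y) y≤ys))
    head-bound : k + (suc n + F) ≤ y + m
    head-bound = begin
      k + (suc n + F)           ≡⟨ cong (λ z → k + (z + F)) t+c≡1+n ⟨
      k + ((t + c) + F)         ≡⟨ a+[k+[c+F]]≡k+[a+c+F] t k c F ⟨
      t + (k + (c + F))         ≤⟨ +-mono-≤ t≤y (+-monoʳ-≤ k (subst (c + F ≤_) count-head c+F≤count)) ⟩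
      y + (k + suc (length ys)) ≡⟨ cong (_+_ y) len ⟩
      y + m                     ∎
      where open ≤-Reasoning
  ... | no t≰y = ℤ.≤-trans
    (maxFrom-≥ (suc k) ys sorted (trans (sym (+-suc k _)) len) t+c≡1+n
               (subst (c + F ≤_) (cong length (filter-reject (t ≤?_) t≰y)) c+F≤count))
    (ℤ.i≤j⊔i _ _)

lookup⇒All : ∀ {p k} {P : Pred ℕ p} (v : Vec ℕ k) → (∀ i → P (lookup v i)) → All P (toList v)
lookup⇒All []      _ = []
lookup⇒All (y ∷ v) P[v] = P[v] fzero ∷ lookup⇒All v (P[v] ∘ fsuc)

NonDecreasing⇒AllPairs : ∀ {k} (v : Vec ℕ k) → NonDecreasing v → AllPairs _≤_ (toList v)
NonDecreasing⇒AllPairs []      _ = []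
NonDecreasing⇒AllPairs (y ∷ v) mono =
  lookup⇒All v (λ i → mono fzero (fsuc i) z≤n)
  ∷ NonDecreasing⇒AllPairs v (λ i j i≤j → mono (fsuc i) (fsuc j) (s≤s i≤j))

theorem1p2 : (m n d : ℕ) → 1 ≤ m → 1 ≤ n → (x x' : Vec ℕ m) → InRange n x
    → toList x' ↭ toList x → NonDecreasing x'
    → (DPF m n d x ⇔ (maxTerm m n x' ≡ + d))
theorem1p2 m n d _ _ x x' inRange x'↭x nonDecreasing =
  mk⇔ (λ (_ , dft≡d) → trans maxTerm≡dft (cong +_ dft≡d))
      (λ maxTerm≡d → inRange , ℤ.+-injective (trans (sym maxTerm≡dft) maxTerm≡d))
  where
  open SortedMaximum m n
  prefs : All (λ y → 1 ≤ y × y ≤ suc n) (toList x)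
  prefs = lookup⇒All x inRange
  sorted : AllPairs _≤_ (toList x')
  sorted = NonDecreasing⇒AllPairs x' nonDecreasing
  count≥-↭ : ∀ t → count≥ t (toList x) ≡ count≥ t (toList x')
  count≥-↭ t = sym (↭-length (filter-↭ (t ≤?_) x'↭x))
  upper : maxFrom 0 (toList x') ℤ.≤ + dft n x
  upper = maxFrom-≤ 0 _ sorted (All-resp-↭ (↭-sym x'↭x) (All.map proj₂ prefs)) (length-toList x')
            λ t c e → subst (_≤ c + dft n x) (count≥-↭ t) (dft-upper n x t c e)
  lower : + dft n x ℤ.≤ maxFrom 0 (toList x')
  lower = let t , c , e , attained = dft-attained n x (All.map proj₁ prefs) in
          maxFrom-≥ 0 _ sorted (length-toList x') e (subst (c + dft n x ≤_) (count≥-↭ t) attained)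
  maxTerm≡dft : maxTerm m n x' ≡ + dft n x
  maxTerm≡dft = trans (maxTerm≡maxFrom x') (ℤ.≤-antisym upper lower)
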